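{- Let $n\ge 1$ and let $X$ be minimal for $\omega^{2n-1}$-largeness. Then there exists a coloring $f_X:X\to 2$ such that no subset of $X$ is both $f_X$-homogeneous and $\omega^n$-large$(T_X)$.
   Context: Ordinary largeness of finite sets: $X$ is $\omega^0$-large iff nonempty; $\omega^{b+1}$-large iff $X\setminus\{\min X\}$ is $\omega^b\cdot(\min X)$-large; $\omega^b\cdot k$-large iff it contains $k$ subsets $X_0<\dots<X_{k-1}$ each $\omega^b$-large (only sets with $\min X\ge 3$ are considered). $X$ is minimal for $\omega^m$-largeness if it is $\omega^m$-large and $X\setminus\{x\}$ is not $\omega^m$-large for each $x\in X$. For $m\ge 1$, a minimal $\omega^m$-large $X$ has a unique decomposition $X=\{\min X\}\cup X_0\cup\dots\cup X_{\min X-1}$ with $X_0<\dots<X_{\min X-1}$ each minimal for $\omega^{m-1}$-largeness. Canonical blocks: the canonical $m$-block of $X$ is $X$ itself; for $c<m$ the canonical $c$-blocks of $X$ are the canonical $c$-blocks of the $X_i$. Let $\phi_X(x,y,c)$ mean that $x,y$ lie in the same canonical $c$-block of $X$ ($c\le m$), let $\theta_X(x,y,z)$ be $(x\in X\wedge z\in X\wedge z\ge y)\rightarrow\exists c\le m\,(\phi_X(y,z,c)\wedge\neg\phi_X(x,y,c)\wedge y>x\wedge y\in X)$, and $T_X\equiv\forall x\exists y\forall z\,\theta_X(x,y,z)$. Finite $A<B$ are $T_X$-apart if $\forall x<\max A\,\exists y<\min B\,\forall z<\max B\,\theta_X(x,y,z)$. $\omega^b$-largeness$(T_X)$ is defined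 like ordinary largeness but requiring the $k$ subsets $X_0<\dots<X_{k-1}$ in the $\omega^b\cdot k$ clause to be pairwise $T_X$-apart. -}

module Defs where

open import Data.Nat using (ℕ; zero; suc; _<_; _≤_; _⊔_)
open import Data.Bool using (Bool)
open import Data.List using (List; []; _∷_; length; concat; foldr)
open import Data.List.Membership.Propositional using (_∈_)
open import Data.List.Relation.Unary.All using (All)
open import Data.List.Relation.Unary.Any using (_─_)
open import Data.List.Relation.Unary.AllPairs using (AllPairs)
open import Data.List.Relation.Binary.Sublist.Propositional using (_⊆_)
open import Data.Product using (Σ; ∃; ∃-syntax; _×_)
open import Data.Empty using (⊥)
open import Data.Unit using (⊤)
open import Relation.Nullary using (¬_)
open import Relation.Binary.PropositionalEquality using (_≡_)

-- Finite sets of naturals are represented as strictly increasing lists;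
-- subsets of a set X are sublists of X (hence again strictly increasing).

minL : List ℕ → ℕ
minL []      = 0
minL (x ∷ _) = x

maxL : List ℕ → ℕ
maxL = foldr _⊔_ 0

_<ˢ_ : List ℕ → List ℕ → Set
A <ˢ B = ∀ {a b} → a ∈ A → b ∈ B → a < b

-- Largeness parameterised by the relation R required between the k
-- consecutive subsets in the ω^b·k clause.
LargeWith : (List ℕ → List ℕ → Set) → ℕ → List ℕ → Set
LargeWith R zero    []       = ⊥
LargeWith R zero    (_ ∷ _)  = Σ ℕ λ _ → Σ ℕ λ _ → Σ ℕ λ _ → ℕ → ℕ → ℕ → ℕ → ℕ → ℕ → ℕ → ℕ → ℕ → ℕ → ℕ → ℕ → ℕ → ℕ
LargeWith R (suc b) []       = ⊥
LargeWith R (suc b) (x ∷ xs) =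
  Σ (List (List ℕ)) λ Ys →
    length Ys ≡ x × All (_⊆ xs) Ys × All (LargeWith R b) Ys × AllPairs R Ys

Large : ℕ → List ℕ → Set
Large = LargeWith _<ˢ_

Minimal : ℕ → List ℕ → Set
Minimal m X = Large m X × (∀ {x} (p : x ∈ X) → ¬ Large m (X ─ p))

-- The canonical m-block of X is X; for c < m+1 the canonical c-blocks of X
-- are those of the pieces X_i of the decomposition
-- X = {min X} ∪ X_0 ∪ ... ∪ X_{min X - 1}, X_0 < ... < X_{min X -1},
-- each X_i minimal for ω^m-largeness.
data CBlock : ℕ → List ℕ → ℕ → List ℕ → Set where
  self : ∀ {m X} → CBlock m X m X
  sub  : ∀ {m X x Ys Y c B} →
         X ≡ x ∷ concat Ys → length Ys ≡ x → All (Minimal m) Ys →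
         AllPairs _<ˢ_ Ys → Y ∈ Ys → CBlock m Y c B →
         CBlock (suc m) X c B

φ : ℕ → List ℕ → ℕ → ℕ → ℕ → Set
φ m X x y c = ∃[ B ] (CBlock m X c B × x ∈ B × y ∈ B)

θ : ℕ → List ℕ → ℕ → ℕ → ℕ → Set
θ m X x y z =
  (x ∈ X × z ∈ X × y ≤ z) →
  ∃[ c ] (c ≤ m × φ m X y z c × ¬ φ m X x y c × x < y × y ∈ X)

Apart : ℕ → List ℕ → List ℕ → List ℕ → Set
Apart m X A B =
  ∀ x → x < maxL A → ∃[ y ] (y < minL B × (∀ z → z < maxL B → θ m X x y z))

LargeT : ℕ → List ℕ → ℕ → List ℕ → Set
LargeT m X = LargeWith (λ A B → A <ˢ B × Apart m X A B)

Homogeneous : (ℕ → Bool) → List ℕ → Set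
Homogeneous f Y = ∃[ i ] All (λ y → f y ≡ i) Y

-- Colour a ∈ X by whether a = min X.  A homogeneous set of the first colour is a
-- singleton, so it suffices that no ω^n-large(T_X) set Y ⊆ X avoids min X.  By induction
-- on k: if Y ⊆ X is ω^(k+1)-large(T_X) and a canonical c-block C with min C < min Y
-- contains every element of Y but its maximum, then c ≥ 2k+2; for C = X, of level 2n-1,
-- this is impossible.  For k = 0, Y has at least min Y + 1 elements, more than a canonical
-- block of level ≤ 1 holds above its minimum.  In the step, apartness of two pieces A < B
-- of Y, tested at their penultimate elements q_A and q_B, gives a canonical block D
-- containing q_B but not q_A, of level ≥ 2k+2 by induction.  If c ≤ 2k+3, laminarity of
-- canonical blocks makes each such D a child of C, so the min Y penultimate elements lie
-- in distinct children of C, of which there are only min C < min Y.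

module Submission where

open import Defs
open import Data.Nat using (ℕ; zero; suc; _+_; _≤_; _<_; _*_; _∸_; _≡ᵇ_; z≤n; s≤s; _≤?_; _<?_)
open import Data.Nat.Properties
open import Data.Bool using (Bool; true; false; T)
open import Data.List using (List; []; _∷_; _++_; [_]; length; concat; map; take; _∷ʳ′_; initLast)
open import Data.List.Properties using (∷-injective; ++-conicalˡ; length-++; length-take; length-map)
open import Data.List.Membership.Propositional using (_∈_; _∉_)
open import Data.List.Membership.Propositional.Properties
  using (∈-++⁻; ∈-++⁺ˡ; ∈-insert; ∈-concat⁺; ∈-concat⁻′; ∈-concat⁺′)
open import Data.List.Relation.Unary.All as All using (All; []; _∷_)
open import Data.List.Relation.Unary.All.Properties as All using ()
open import Data.List.Relation.Unary.Any as Any using (Any; here; there; _─_)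
open import Data.List.Relation.Unary.AllPairs as AllPairs using (AllPairs; []; _∷_)
import Data.List.Relation.Unary.AllPairs.Properties as AllPairs
open import Data.List.Relation.Unary.Linked using (Linked; []; [-]; _∷_)
open import Data.List.Relation.Unary.Linked.Properties using (Linked⇒AllPairs; AllPairs⇒Linked)
open import Data.List.Relation.Binary.Sublist.Propositional
  using (_⊆_; []; _∷_; _∷ʳ_; ⊆-refl; ⊆-trans; from∈)
  renaming (lookup to ∈-resp-⊆)
open import Data.List.Relation.Binary.Sublist.Propositional.Properties
  using (All-resp-⊆; length-mono-≤; ++⁺ʳ; ++⁺ˡ; take-⊆; []⊆-universal)
open import Data.Product using (∃; ∃₂; ∃-syntax; _×_; _,_; proj₁)
open import Data.Sum using (_⊎_; inj₁; inj₂)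
open import Data.Empty using (⊥-elim)
open import Data.Unit using (tt)
open import Relation.Nullary using (¬_; yes; no)
open import Relation.Binary.PropositionalEquality using (_≡_; refl; sym; trans; cong; subst)

AllPairs-resp-⊆ : ∀ {A : Set} {R : A → A → Set} {xs ys : List A} →
  xs ⊆ ys → AllPairs R ys → AllPairs R xs
AllPairs-resp-⊆ []         []         = []
AllPairs-resp-⊆ (y ∷ʳ τ)   (_ ∷ rys)  = AllPairs-resp-⊆ τ rys
AllPairs-resp-⊆ (refl ∷ τ) (ry ∷ rys) = All-resp-⊆ τ ry ∷ AllPairs-resp-⊆ τ rys

AllPairs-withAll : ∀ {A : Set} {P : A → Set} {R S : A → A → Set} →
  (∀ {a b} → P a → P b → R a b → S a b) → ∀ {xs} → All P xs → AllPairs R xs → AllPairs S xs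
AllPairs-withAll f []        []        = []
AllPairs-withAll f (pa ∷ ps) (ra ∷ rs) =
  All.zipWith (λ (pb , r) → f pa pb r) (ps , ra) ∷ AllPairs-withAll f ps rs

AllPairs-∈-compare : ∀ {A : Set} {R : A → A → Set} {xs x y} → AllPairs R xs → x ∈ xs → y ∈ xs →
  x ≡ y ⊎ R x y ⊎ R y x
AllPairs-∈-compare _          (here refl) (here refl) = inj₁ refl
AllPairs-∈-compare (x<xs ∷ _) (here refl) (there y∈)  = inj₂ (inj₁ (All.lookup x<xs y∈))
AllPairs-∈-compare (y<xs ∷ _) (there x∈)  (here refl) = inj₂ (inj₂ (All.lookup y<xs x∈))
AllPairs-∈-compare (_ ∷ rs)   (there x∈)  (there y∈)  = AllPairs-∈-compare rs x∈ y∈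

─-⊆ : ∀ {A : Set} {x : A} {xs} (p : x ∈ xs) → (xs ─ p) ⊆ xs
─-⊆ (here refl) = _ ∷ʳ ⊆-refl
─-⊆ (there p)   = refl ∷ ─-⊆ p

prefix-⊆-─ : ∀ {A : Set} (Z : List A) {w W} → Z ⊆ ((Z ++ w ∷ W) ─ ∈-insert Z)
prefix-⊆-─ []      = []⊆-universal _
prefix-⊆-─ (z ∷ Z) = refl ∷ prefix-⊆-─ Z

++-compare : ∀ {A : Set} (Y Z : List A) {R R′} → Y ++ R ≡ Z ++ R′ →
  (Y ≡ Z × R ≡ R′) ⊎ (∃₂ λ w W → Y ≡ Z ++ w ∷ W) ⊎ (∃₂ λ w W → Z ≡ Y ++ w ∷ W)
++-compare []      []      eq = inj₁ (refl , eq)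
++-compare []      (z ∷ Z) _  = inj₂ (inj₂ (z , Z , refl))
++-compare (y ∷ Y) []      _  = inj₂ (inj₁ (y , Y , refl))
++-compare (y ∷ Y) (z ∷ Z) eq with ∷-injective eq
... | refl , eq′ with ++-compare Y Z eq′
... | inj₁ (refl , R≡R′)          = inj₁ (refl , R≡R′)
... | inj₂ (inj₁ (w , W , refl)) = inj₂ (inj₁ (w , W , refl))
... | inj₂ (inj₂ (w , W , refl)) = inj₂ (inj₂ (w , W , refl))

∃-split-at : ∀ {A : Set} n (xs : List A) → n < length xs →
  ∃₂ λ ds e → ∃ λ es → xs ≡ ds ++ e ∷ es × length ds ≡ n
∃-split-at zero    (x ∷ xs) _ = [] , x , xs , refl , refl
∃-split-at (suc n) (x ∷ xs) (s≤s n<) with ∃-split-at n xs n<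
... | ds , e , es , refl , refl = x ∷ ds , e , es , refl , refl

∈⇒⊆-concat : ∀ {A : Set} {Y : List A} {Ys} → Y ∈ Ys → Y ⊆ concat Ys
∈⇒⊆-concat {Ys = _ ∷ Ys} (here refl) = ++⁺ʳ (concat Ys) ⊆-refl
∈⇒⊆-concat {Ys = Y′ ∷ _} (there Y∈)  = ++⁺ˡ Y′ (∈⇒⊆-concat Y∈)

Increasing : List ℕ → Set
Increasing = AllPairs _<_

head<tail : ∀ {x xs z} → Increasing (x ∷ xs) → z ∈ xs → x < z
head<tail (x<xs ∷ _) = All.lookup x<xs

minL≤ : ∀ {x xs} → Increasing xs → x ∈ xs → minL xs ≤ x
minL≤ _   (here refl) = ≤-refl
minL≤ inc (there x∈)  = <⇒≤ (head<tail inc x∈)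

≤maxL : ∀ {x xs} → x ∈ xs → x ≤ maxL xs
≤maxL {xs = y ∷ ys} (here refl) = m≤m⊔n y (maxL ys)
≤maxL {xs = y ∷ ys} (there x∈)  = ≤-trans (≤maxL x∈) (m≤n⊔m y (maxL ys))

maxL-lub : ∀ {xs M} → All (_≤ M) xs → maxL xs ≤ M
maxL-lub []       = z≤n
maxL-lub (p ∷ ps) = ⊔-lub p (maxL-lub ps)

maxL-mono-⊆ : ∀ {xs ys} → xs ⊆ ys → maxL xs ≤ maxL ys
maxL-mono-⊆ τ = maxL-lub (All.tabulate (λ x∈ → ≤maxL (∈-resp-⊆ τ x∈)))

maxL-∷ : ∀ {a b bs} → a < b → maxL (a ∷ b ∷ bs) ≡ maxL (b ∷ bs)
maxL-∷ {b = b} {bs} a<b = m≤n⇒m⊔n≡n (≤-trans (<⇒≤ a<b) (m≤m⊔n b (maxL bs)))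

∈-tail : ∀ {x xs z} → z ∈ x ∷ xs → x < z → z ∈ xs
∈-tail (here refl) x<x = ⊥-elim (<-irrefl refl x<x)
∈-tail (there z∈)  _   = z∈

increasing-⊆ : ∀ {xs ys} → Increasing xs → Increasing ys → All (_∈ ys) xs → xs ⊆ ys
increasing-⊆ {[]}     _    _ _ = []⊆-universal _
increasing-⊆ {x ∷ xs} {y ∷ ys} incX@(x<xs ∷ incXs) incY@(_ ∷ incYs) (x∈ ∷ xs∈) with x∈
... | here refl = refl ∷ increasing-⊆ incXs incYs
  (All.zipWith (λ (z∈ , x<z) → ∈-tail z∈ x<z) (xs∈ , x<xs))
... | there x∈ys = y ∷ʳ increasing-⊆ incX incYs
  (∈-tail x∈ y<x ∷ All.zipWith (λ (z∈ , x<z) → ∈-tail z∈ (<-trans y<x x<z)) (xs∈ , x<xs))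
  where y<x = head<tail incY x∈ys

prefix-increasing : ∀ xs {ys} → Increasing (xs ++ ys) → Increasing xs
prefix-increasing _ {ys} = AllPairs-resp-⊆ (++⁺ʳ ys ⊆-refl)

suffix-increasing : ∀ xs {ys} → Increasing (xs ++ ys) → Increasing ys
suffix-increasing xs = AllPairs-resp-⊆ (++⁺ˡ xs ⊆-refl)

IsPenultimate : List ℕ → ℕ → Set
IsPenultimate P q = q ∈ P × q < maxL P × (∀ {z} → z ∈ P → z < maxL P → z ≤ q)

penultimate : List ℕ → ℕ
penultimate (a ∷ b ∷ [])     = a
penultimate (a ∷ b ∷ c ∷ cs) = penultimate (b ∷ c ∷ cs)
penultimate _                = 0  -- junk value for lists with fewer than two elements

penultimate-spec : ∀ {a b bs} → Increasing (a ∷ b ∷ bs) →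
  IsPenultimate (a ∷ b ∷ bs) (penultimate (a ∷ b ∷ bs))
penultimate-spec {a} {b} {[]} ((a<b ∷ []) ∷ _)
  rewrite maxL-∷ {a} {b} {[]} a<b | ⊔-identityʳ b = here refl , a<b , below
  where
  below : ∀ {z} → z ∈ a ∷ b ∷ [] → z < b → z ≤ a
  below (here refl)         _   = ≤-refl
  below (there (here refl)) b<b = ⊥-elim (<-irrefl refl b<b)
penultimate-spec {a} {b} {c ∷ cs} inc@((a<b ∷ _) ∷ incT) with penultimate-spec incT
... | q∈ , q<max , below rewrite maxL-∷ {a} {b} {c ∷ cs} a<b = there q∈ , q<max , below′
  where
  below′ : ∀ {z} → z ∈ a ∷ b ∷ c ∷ cs → z < maxL (b ∷ c ∷ cs) → z ≤ penultimate (b ∷ c ∷ cs)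
  below′ (here refl) _ = <⇒≤ (head<tail inc q∈)
  below′ (there z∈)  z< = below z∈ z<

Covers : List ℕ → List ℕ → Set
Covers C Y = ∀ {z} → z ∈ Y → z < maxL Y → z ∈ C

below-last : ∀ I {l} → Increasing (I ++ [ l ]) → All (_< l) I
below-last []      _          = []
below-last (i ∷ I) (i< ∷ inc) = All.lookup i< (∈-insert I) ∷ below-last I inc

covered-length : ∀ {h cs Y} → Increasing Y → Increasing (h ∷ cs) → Covers (h ∷ cs) Y →
  h < minL Y → length Y ≤ suc (length cs)
covered-length {h} {cs} {Y} incY incC cov h<Y with initLast Y
... | []       = z≤n
... | I ∷ʳ′ l  = begin
  length (I ++ [ l ])  ≡⟨ length-++ I ⟩
  length I + 1         ≡⟨ +-comm (length I) 1 ⟩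
  suc (length I)       ≤⟨ s≤s (length-mono-≤ I⊆cs) ⟩
  suc (length cs)      ∎
  where
  open ≤-Reasoning
  I∈cs : ∀ {z} → z ∈ I → z ∈ cs
  I∈cs z∈ = ∈-tail
    (cov (∈-++⁺ˡ z∈) (<-≤-trans (All.lookup (below-last I incY) z∈) (≤maxL (∈-insert I))))
    (<-≤-trans h<Y (minL≤ incY (∈-++⁺ˡ z∈)))
  I⊆cs : I ⊆ cs
  I⊆cs = increasing-⊆ (prefix-increasing I incY) (AllPairs.tail incC) (All.tabulate I∈cs)

Separates : List (List ℕ) → ℕ → ℕ → Set
Separates Ws e e′ = Any (λ W → e′ ∈ W × e ∉ W) Ws

separates-tail : ∀ {W Ws e e′} → e′ ∉ W → Separates (W ∷ Ws) e e′ → Separates Ws e e′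
separates-tail e′∉W (here (e′∈W , _)) = ⊥-elim (e′∉W e′∈W)
separates-tail _    (there s)         = s

below-later-blocks : ∀ {W Ws z e} → All (W <ˢ_) Ws → z ∈ W → e ∈ concat Ws → z < e
below-later-blocks {Ws = Ws} W<Ws z∈W e∈ with ∈-concat⁻′ Ws e∈
... | V , e∈V , V∈ = All.lookup W<Ws V∈ z∈W e∈V

-- Along L the blocks containing its elements move strictly to the right.
separated⇒length≤ : ∀ Ws {L} → AllPairs _<ˢ_ Ws → Increasing L → All (_∈ concat Ws) L →
  Linked (Separates Ws) L → length L ≤ length Ws
separated⇒length≤ _        {[]}         _ _ _ _ = z≤n
separated⇒length≤ []       {e ∷ _}      _ _ (() ∷ _) _
separated⇒length≤ (W ∷ Ws) {e ∷ []}     _ _ _ _ = s≤s z≤n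
separated⇒length≤ (W ∷ Ws) {e ∷ e′ ∷ L} (W<Ws ∷ ordWs) ((e<e′ ∷ _) ∷ incL) (e∈ ∷ L∈) (sep ∷ seps) =
  s≤s (separated⇒length≤ Ws ordWs incL (All.zipWith leave-W (avoid , L∈)) (leave-W-linked avoid seps))
  where
  e′∈Ws : e′ ∈ concat Ws
  e′∈Ws = later sep
    where
    later : Separates (W ∷ Ws) e e′ → e′ ∈ concat Ws
    later (there s) = ∈-concat⁺ (Any.map proj₁ s)
    later (here (e′∈W , e∉W)) with ∈-++⁻ W e∈
    ... | inj₁ e∈W  = ⊥-elim (e∉W e∈W)
    ... | inj₂ e∈Ws = ⊥-elim (<-asym e<e′ (below-later-blocks W<Ws e′∈W e∈Ws))
  avoid : All (_∉ W) (e′ ∷ L)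
  avoid = All.tabulate λ z∈ z∈W → <⇒≱ (below-later-blocks W<Ws z∈W e′∈Ws) (minL≤ incL z∈)
  leave-W : ∀ {z} → z ∉ W × z ∈ W ++ concat Ws → z ∈ concat Ws
  leave-W (z∉W , z∈) with ∈-++⁻ W z∈
  ... | inj₁ z∈W  = ⊥-elim (z∉W z∈W)
  ... | inj₂ z∈Ws = z∈Ws
  leave-W-linked : ∀ {L} → All (_∉ W) L → Linked (Separates (W ∷ Ws)) L → Linked (Separates Ws) L
  leave-W-linked _                  []       = []
  leave-W-linked _                  [-]      = [-]
  leave-W-linked (_ ∷ av@(b∉W ∷ _)) (s ∷ ss) = separates-tail b∉W s ∷ leave-W-linked av ss

<ˢ-blocks-disjoint : ∀ {Ws W W′ u} → AllPairs _<ˢ_ Ws → W ∈ Ws → W′ ∈ Ws → u ∈ W → u ∈ W′ → W ≡ W′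
<ˢ-blocks-disjoint ord W∈ W′∈ u∈W u∈W′ with AllPairs-∈-compare ord W∈ W′∈
... | inj₁ W≡W′         = W≡W′
... | inj₂ (inj₁ W<W′)  = ⊥-elim (<-irrefl refl (W<W′ u∈W u∈W′))
... | inj₂ (inj₂ W′<W)  = ⊥-elim (<-irrefl refl (W′<W u∈W′ u∈W))

-- Largeness

-- Defs encodes ω⁰-largeness of a nonempty set by an (inhabited) dummy type.
large₀ : ∀ {R x xs} → LargeWith R 0 (x ∷ xs)
large₀ = 0 , 0 , 0 , λ _ _ _ _ _ _ _ _ _ _ _ _ _ → 0

large-nonempty : ∀ {R b} → ¬ LargeWith R b []
large-nonempty {b = zero}  ()
large-nonempty {b = suc b} ()

minL∈ : ∀ {R b Y} → LargeWith R b Y → minL Y ∈ Y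
minL∈ {Y = []}    l = ⊥-elim (large-nonempty l)
minL∈ {Y = _ ∷ _} _ = here refl

large-weaken : ∀ {R S} → (∀ {A B} → R A B → S A B) → ∀ b {Y} → LargeWith R b Y → LargeWith S b Y
large-weaken f zero    {_ ∷ _} l = l
large-weaken f (suc b) {_ ∷ _} (Ys , len , Ys⊆ , Ys-large , Ys-related) =
  Ys , len , Ys⊆ , All.map (large-weaken f b) Ys-large , AllPairs.map f Ys-related

large-resp-⊆ : ∀ {R} b {Z V} → LargeWith R b Z → Z ⊆ V → Increasing V → LargeWith R b V
large-resp-⊆ zero    {_ ∷ _} l (_ ∷ʳ _) _ = l
large-resp-⊆ zero    {_ ∷ _} l (refl ∷ _) _ = l
large-resp-⊆ (suc b) {_ ∷ _} (Ys , len , Ys⊆ , rest) (refl ∷ τ) _ =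
  Ys , len , All.map (λ σ → ⊆-trans σ τ) Ys⊆ , rest
large-resp-⊆ (suc b) {z ∷ zs} {v ∷ vs} (Ys , len , Ys⊆ , Ys-large , Ys-related) (v ∷ʳ τ) incV =
  take v Ys , length-take-v ,
  All-resp-⊆ (take-⊆ v Ys) (All.map (λ σ → ⊆-trans σ (⊆-trans (z ∷ʳ ⊆-refl) τ)) Ys⊆) ,
  All-resp-⊆ (take-⊆ v Ys) Ys-large , AllPairs.take⁺ v Ys-related
  where
  -- v < z, so fewer pieces are needed for the new minimum
  length-take-v : length (take v Ys) ≡ v
  length-take-v = trans (length-take v Ys)
    (m≤n⇒m⊓n≡m (subst (v ≤_) (sym len) (<⇒≤ (head<tail incV (∈-resp-⊆ τ (here refl))))))

large⇒tail-nonempty : ∀ {R b y ys} → LargeWith R (suc b) (y ∷ ys) → 0 < y → ∃₂ λ a as → ys ≡ a ∷ as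
large⇒tail-nonempty ([] , len , _) 0<y = ⊥-elim (<-irrefl len 0<y)
large⇒tail-nonempty {ys = []}     ((_ ∷ _) , _ , ([] ∷ _) , (l ∷ _) , _) _ = ⊥-elim (large-nonempty l)
large⇒tail-nonempty {ys = a ∷ as} _ _ = a , as , refl

-- The minima of the y disjoint pieces are y distinct elements of ys.
ω¹-large⇒min≤length : ∀ {y ys} → Large 1 (y ∷ ys) → Increasing ys → y ≤ length ys
ω¹-large⇒min≤length {y} {ys} (Ys , refl , Ys⊆ , Ys-large , Ys<) incYs = begin
  length Ys              ≡⟨ length-map minL Ys ⟨
  length (map minL Ys)   ≤⟨ length-mono-≤ (increasing-⊆ mins-increasing incYs mins∈ys) ⟩
  length ys              ∎
  where
  open ≤-Reasoning
  mins-increasing : Increasing (map minL Ys)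
  mins-increasing =
    AllPairs.map⁺ (AllPairs-withAll (λ lA lB A<B → A<B (minL∈ lA) (minL∈ lB)) Ys-large Ys<)
  mins∈ys : All (_∈ ys) (map minL Ys)
  mins∈ys = All.map⁺ (All.zipWith (λ (σ , l) → ∈-resp-⊆ σ (minL∈ l)) (Ys⊆ , Ys-large))

singletons-large : ∀ {zs} → Increasing zs → Large 1 (length zs ∷ zs)
singletons-large {zs} inc =
  map [_] zs , length-map [_] zs , All.map⁺ (All.tabulate from∈) ,
  All.map⁺ {f = [_]} (All.tabulate (λ {z} _ → large₀ {_<ˢ_} {z} {[]})) ,
  AllPairs.map⁺ (AllPairs.map (λ { z<z′ (here refl) (here refl) → z<z′ }) inc)

-- Minimal sets and their decompositions

minimal⇒¬large-prefix : ∀ {m} Z {w W} → Increasing (Z ++ w ∷ W) → Minimal m (Z ++ w ∷ W) → ¬ Large m Z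
minimal⇒¬large-prefix {m} Z inc (_ , minimal) largeZ =
  minimal (∈-insert Z) (large-resp-⊆ m largeZ (prefix-⊆-─ Z) (AllPairs-resp-⊆ (─-⊆ (∈-insert Z)) inc))

-- No minimal piece can be a proper prefix of another.
minimal-concat-injective : ∀ {m} Ys Zs → Increasing (concat Ys) →
  All (Minimal m) Ys → All (Minimal m) Zs → concat Ys ≡ concat Zs → Ys ≡ Zs
minimal-concat-injective []       []       _ _ _ _ = refl
minimal-concat-injective []       (Z ∷ Zs) _ _ ((Z-large , _) ∷ _) eq =
  ⊥-elim (large-nonempty (subst (Large _) (++-conicalˡ Z _ (sym eq)) Z-large))
minimal-concat-injective (Y ∷ Ys) []       _ ((Y-large , _) ∷ _) _ eq =
  ⊥-elim (large-nonempty (subst (Large _) (++-conicalˡ Y _ eq) Y-large))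
minimal-concat-injective (Y ∷ Ys) (Z ∷ Zs) inc (Y-min ∷ Ys-min) (Z-min ∷ Zs-min) eq
  with ++-compare Y Z eq
... | inj₁ (refl , rest) =
  cong (Y ∷_) (minimal-concat-injective Ys Zs (suffix-increasing Y inc) Ys-min Zs-min rest)
... | inj₂ (inj₁ (w , W , refl)) =
  ⊥-elim (minimal⇒¬large-prefix Z (prefix-increasing (Z ++ w ∷ W) inc) Y-min (proj₁ Z-min))
... | inj₂ (inj₂ (w , W , refl)) =
  ⊥-elim (minimal⇒¬large-prefix Y (prefix-increasing (Y ++ w ∷ W) (subst Increasing eq inc))
    Z-min (proj₁ Y-min))

Decomposition : ℕ → List ℕ → List (List ℕ) → Set
Decomposition c C Ws = ∃[ h ] (C ≡ h ∷ concat Ws × length Ws ≡ h × All (Minimal c) Ws × AllPairs _<ˢ_ Ws)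

decomposition-unique : ∀ {c C Ws Ws′} → Increasing C →
  Decomposition c C Ws → Decomposition c C Ws′ → Ws ≡ Ws′
decomposition-unique incC (_ , refl , _ , mins , _) (_ , eq , _ , mins′ , _) with ∷-injective eq
... | refl , concat≡ = minimal-concat-injective _ _ (AllPairs.tail incC) mins mins′ concat≡

-- For c = 1: if cs had more than h elements, deleting the (h+1)-st would leave h and the
-- h elements before it, an ω¹-large set.
minimal≤1-length : ∀ {c h cs} → c ≤ 1 → Increasing (h ∷ cs) → Minimal c (h ∷ cs) → length cs ≤ h
minimal≤1-length {cs = []}    _ _ _ = z≤n
minimal≤1-length {zero} {cs = _ ∷ _} _ _ (_ , minimal) =
  ⊥-elim (minimal (there (here refl)) (large₀ {_<ˢ_} {0} {[]}))
minimal≤1-length {suc (suc _)} {cs = _ ∷ _} (s≤s ()) _ _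
minimal≤1-length {suc zero} {h} {cs} _ inc min with h <? length cs
... | no h≮ = ≮⇒≥ h≮
... | yes h< with ∃-split-at h cs h<
... | ds , e , es , refl , refl =
  ⊥-elim (minimal⇒¬large-prefix (length ds ∷ ds) inc min
    (singletons-large (prefix-increasing ds (AllPairs.tail inc))))

-- Canonical blocks

block-⊆ : ∀ {m X c B} → CBlock m X c B → B ⊆ X
block-⊆ self                                 = ⊆-refl
block-⊆ (sub {x = x} refl _ _ _ Y∈ Y-block) = ⊆-trans (block-⊆ Y-block) (x ∷ʳ ∈⇒⊆-concat Y∈)

block-level : ∀ {m X c B} → CBlock m X c B → c ≤ m
block-level self                   = ≤-refl
block-level (sub _ _ _ _ _ Y-block) = m≤n⇒m≤1+n (block-level Y-block)

block-minimal : ∀ {m X c B} → Minimal m X → CBlock m X c B → Minimal c B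
block-minimal minX self                       = minX
block-minimal _    (sub _ _ mins _ Y∈ Y-block) = block-minimal (All.lookup mins Y∈) Y-block

block-convex : ∀ {m X c B a b z} → Increasing X → CBlock m X c B → a ∈ B → b ∈ B → z ∈ X →
  a ≤ z → z ≤ b → z ∈ B
block-convex _ self _ _ z∈ _ _ = z∈
block-convex incX (sub refl _ _ _ Y∈ Y-block) a∈ _ (here refl) a≤z _ =
  ⊥-elim (<⇒≱ (head<tail incX (∈-concat⁺′ (∈-resp-⊆ (block-⊆ Y-block) a∈) Y∈)) a≤z)
block-convex incX (sub {x = x} {Ys} refl _ _ ord Y∈ Y-block) a∈ b∈ (there z∈) a≤z z≤b
  with ∈-concat⁻′ Ys z∈
... | Y′ , z∈Y′ , Y′∈ with AllPairs-∈-compare ord Y∈ Y′∈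
... | inj₁ refl = block-convex (AllPairs-resp-⊆ (x ∷ʳ ∈⇒⊆-concat Y∈) incX) Y-block a∈ b∈ z∈Y′ a≤z z≤b
... | inj₂ (inj₁ Y<Y′) = ⊥-elim (<⇒≱ (Y<Y′ (∈-resp-⊆ (block-⊆ Y-block) b∈) z∈Y′) z≤b)
... | inj₂ (inj₂ Y′<Y) = ⊥-elim (<⇒≱ (Y′<Y z∈Y′ (∈-resp-⊆ (block-⊆ Y-block) a∈)) a≤z)

-- Two canonical blocks that meet are nested: decompositions are unique, and
-- distinct pieces of a decomposition are disjoint.
blocks-laminar : ∀ {m X c₁ B₁ c₂ B₂ u} → Increasing X → CBlock m X c₁ B₁ → CBlock m X c₂ B₂ →
  c₁ ≤ c₂ → u ∈ B₁ → u ∈ B₂ → CBlock c₂ B₂ c₁ B₁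
blocks-laminar _ B₁-block self _ _ _ = B₁-block
blocks-laminar _ self (sub _ _ _ _ _ Y-block) c≤ _ _ = ⊥-elim (<⇒≱ (s≤s (block-level Y-block)) c≤)
blocks-laminar incX (sub {x = x} {Ys} refl len₁ mins₁ ord₁ Y₁∈ Y₁-block)
                    (sub {Ys = Zs} eq len₂ mins₂ ord₂ Y₂∈ Y₂-block) c≤ u∈B₁ u∈B₂
  with decomposition-unique incX (x , refl , len₁ , mins₁ , ord₁) (_ , eq , len₂ , mins₂ , ord₂)
... | refl with <ˢ-blocks-disjoint ord₁ Y₁∈ Y₂∈
                   (∈-resp-⊆ (block-⊆ Y₁-block) u∈B₁) (∈-resp-⊆ (block-⊆ Y₂-block) u∈B₂)
... | refl = blocks-laminar (AllPairs-resp-⊆ (x ∷ʳ ∈⇒⊆-concat Y₁∈) incX) Y₁-block Y₂-block c≤ u∈B₁ u∈B₂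

block-at-own-level : ∀ {c Y D} → CBlock c Y c D → D ≡ Y
block-at-own-level self                    = refl
block-at-own-level (sub _ _ _ _ _ Y-block) = ⊥-elim (<⇒≱ (s≤s ≤-refl) (block-level Y-block))

child-block : ∀ {c C D} → CBlock (suc c) C c D → ∃[ Ws ] (Decomposition c C Ws × D ∈ Ws)
child-block (sub eq len mins ord Y∈ Y-block) with block-at-own-level Y-block
... | refl = _ , (_ , eq , len , mins , ord) , Y∈


-- Levels of canonical blocks covering a large set

module CoveringBlocks {m : ℕ} {X : List ℕ}
  (incX : Increasing X) (X≥3 : All (3 ≤_) X) (minX : Minimal m X) where

  ⊆X⇒increasing : ∀ {Y} → Y ⊆ X → Increasing Y
  ⊆X⇒increasing Y⊆X = AllPairs-resp-⊆ Y⊆X incX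

  ApartBelow : List ℕ → List ℕ → Set
  ApartBelow A B = A <ˢ B × Apart m X A B

  positive : ∀ {z} → z ∈ X → 0 < z
  positive z∈ = ≤-trans (s≤s z≤n) (All.lookup X≥3 z∈)

  penultimate-piece : ∀ {R b P} → LargeWith R (suc b) P → P ⊆ X → IsPenultimate P (penultimate P)
  penultimate-piece {P = []} ()
  penultimate-piece {P = _ ∷ _} l P⊆X with large⇒tail-nonempty l (positive (∈-resp-⊆ P⊆X (here refl)))
  ... | _ , _ , refl = penultimate-spec (⊆X⇒increasing P⊆X)

  LargeT⇒Large : ∀ b {Y} → LargeT m X b Y → Large b Y
  LargeT⇒Large = large-weaken proj₁

  LevelBound : ℕ → Set
  LevelBound k = ∀ {Y C c} → LargeT m X (suc k) Y → Y ⊆ X → CBlock m X c C →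
    minL C < minL Y → Covers C Y → 2 * suc k ≤ c

  level-bound-base : LevelBound 0
  level-bound-base {[]} ()
  level-bound-base {C = []} _ _ C-block _ _ =
    ⊥-elim (large-nonempty (proj₁ (block-minimal minX C-block)))
  level-bound-base {y ∷ ys} {h ∷ cs} {c} lY Y⊆X C-block h<y cov with 2 ≤? c
  ... | yes 2≤c = 2≤c
  ... | no 2≰c  = ⊥-elim (<-irrefl refl (begin-strict
    y          ≤⟨ ω¹-large⇒min≤length (LargeT⇒Large 1 {y ∷ ys} lY) (AllPairs.tail incY) ⟩
    length ys  ≤⟨ ≤-pred (covered-length incY incC cov h<y) ⟩
    length cs  ≤⟨ minimal≤1-length (≤-pred (≰⇒> 2≰c)) incC (block-minimal minX C-block) ⟩
    h          <⟨ h<y ⟩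
    y          ∎))
    where
    open ≤-Reasoning
    incY = ⊆X⇒increasing Y⊆X
    incC = ⊆X⇒increasing (block-⊆ C-block)

  -- Apartness of A and B, applied at the penultimate element of A and tested against
  -- the penultimate element of B, yields a canonical block D; the level bound for B
  -- inside D is the induction hypothesis.
  apart-block : ∀ {k A B} → LevelBound k → LargeT m X (suc k) A → A ⊆ X → LargeT m X (suc k) B → B ⊆ X →
    ApartBelow A B → ∃₂ λ c D → CBlock m X c D × penultimate B ∈ D × penultimate A ∉ D × 2 * suc k ≤ c
  apart-block {A = A} {B} ih lA A⊆X lB B⊆X (_ , apart)
    with penultimate-piece lA A⊆X | penultimate-piece lB B⊆X
  ... | qA∈A , qA<maxA , _ | qB∈B , qB<maxB , below-qB with apart (penultimate A) qA<maxA
  ... | y′ , y′<B , θs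
    with θs (penultimate B) qB<maxB (∈-resp-⊆ A⊆X qA∈A , ∈-resp-⊆ B⊆X qB∈B ,
                                      <⇒≤ (<-≤-trans y′<B (minL≤ (⊆X⇒increasing B⊆X) qB∈B)))
  ... | c , _ , (D , D-block , y′∈D , qB∈D) , ¬φ , _ =
    c , D , D-block , qB∈D , (λ qA∈D → ¬φ (D , D-block , qA∈D , y′∈D)) , ih lB B⊆X D-block D<B covers
    where
    incB = ⊆X⇒increasing B⊆X
    D<B : minL D < minL B
    D<B = ≤-<-trans (minL≤ (⊆X⇒increasing (block-⊆ D-block)) y′∈D) y′<B
    covers : Covers D B
    covers z∈ z< = block-convex incX D-block y′∈D qB∈D (∈-resp-⊆ B⊆X z∈)
      (≤-trans (<⇒≤ y′<B) (minL≤ incB z∈)) (below-qB z∈ z<)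

  Piece : ℕ → List ℕ → List ℕ → Set
  Piece k C P = LargeT m X (suc k) P × P ⊆ X × penultimate P ∈ C × minL C < penultimate P

  children-separate : ∀ {k A B C c} → LevelBound k → CBlock m X c C → c ≤ suc (2 * suc k) →
    Piece k C A → Piece k C B → ApartBelow A B →
    ∃[ Ws ] (Decomposition (2 * suc k) C Ws × Separates Ws (penultimate A) (penultimate B))
  children-separate {k} {c = c} ih C-block c≤ (lA , A⊆X , qA∈C , _) (lB , B⊆X , qB∈C , _) A⋯B
    with apart-block ih lA A⊆X lB B⊆X A⋯B
  ... | c′ , D , D-block , qB∈D , qA∉D , L≤c′ with c ≤? c′
  ... | yes c≤c′ =
    ⊥-elim (qA∉D (∈-resp-⊆ (block-⊆ (blocks-laminar incX C-block D-block c≤c′ qB∈C qB∈D)) qA∈C))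
  ... | no c≰c′ with c′≡L | c≡1+L | blocks-laminar incX D-block C-block (<⇒≤ c′<c) qB∈D qB∈C
    where
    c′<c = ≰⇒> c≰c′
    c′≡L : c′ ≡ 2 * suc k
    c′≡L = ≤-antisym (≤-pred (≤-trans c′<c c≤)) L≤c′
    c≡1+L : c ≡ suc (2 * suc k)
    c≡1+L = ≤-antisym c≤ (subst (_< c) c′≡L c′<c)
  ... | refl | refl | D-in-C with child-block D-in-C
  ... | Ws , dec , D∈ = Ws , dec , Any.map (λ { refl → qB∈D , qA∉D }) D∈

  -- All separating children come from one decomposition of C, by uniqueness; so the
  -- penultimate elements of the pieces occupy distinct children, of which there are min C.
  pieces-bound : ∀ {k C c Ps} → LevelBound k → CBlock m X c C → c ≤ suc (2 * suc k) →
    All (Piece k C) Ps → AllPairs ApartBelow Ps → 2 ≤ length Ps → length Ps ≤ minL C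
  pieces-bound _ _ _ []       _ ()
  pieces-bound _ _ _ (_ ∷ []) _ (s≤s ())
  pieces-bound {k} {C} {Ps = Ps} ih C-block c≤ pieces@(pA ∷ pB ∷ _) apart@((A⋯B ∷ _) ∷ _) _
    with children-separate ih C-block c≤ pA pB A⋯B
  ... | Ws , dec@(h , refl , len , _ , ord) , _ = begin
    length Ps                   ≡⟨ length-map penultimate Ps ⟨
    length (map penultimate Ps) ≤⟨ separated⇒length≤ Ws ord pens-increasing pens∈Ws pens-separated ⟩
    length Ws                   ≡⟨ len ⟩
    h                           ∎
    where
    open ≤-Reasoning
    pen∈ : ∀ {P} → Piece k C P → penultimate P ∈ P
    pen∈ (lP , P⊆X , _) = proj₁ (penultimate-piece lP P⊆X)
    pens-increasing : Increasing (map penultimate Ps)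
    pens-increasing =
      AllPairs.map⁺ (AllPairs-withAll (λ pA pB A⋯B → proj₁ A⋯B (pen∈ pA) (pen∈ pB)) pieces apart)
    pens∈Ws : All (_∈ concat Ws) (map penultimate Ps)
    pens∈Ws = All.map⁺ (All.map (λ (_ , _ , q∈C , h<q) → ∈-tail q∈C h<q) pieces)
    separated-in-Ws : ∀ {A B} → Piece k C A → Piece k C B → ApartBelow A B →
      Separates Ws (penultimate A) (penultimate B)
    separated-in-Ws pA pB A⋯B with children-separate ih C-block c≤ pA pB A⋯B
    ... | Ws′ , dec′ , s rewrite decomposition-unique (⊆X⇒increasing (block-⊆ C-block)) dec dec′ = s
    pens-separated : Linked (Separates Ws) (map penultimate Ps)
    pens-separated = AllPairs⇒Linked (AllPairs.map⁺ (AllPairs-withAll separated-in-Ws pieces apart))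

  level-bound-step : ∀ {k} → LevelBound k → LevelBound (suc k)
  level-bound-step ih {[]} ()
  level-bound-step {k} ih {y ∷ ys} {C} {c} (Ps , refl , Ps⊆ys , Ps-large , Ps-apart) Y⊆X C-block C<Y cov
    with 2 * suc (suc k) ≤? c
  ... | yes bound = bound
  ... | no c≰    =
    ⊥-elim (<⇒≱ C<Y
      (pieces-bound ih C-block c≤ (All.zipWith piece (Ps-large , Ps⊆ys)) Ps-apart two-pieces))
    where
    incY = ⊆X⇒increasing Y⊆X
    c≤ : c ≤ suc (2 * suc k)
    c≤ = ≤-pred (subst (c <_) (*-suc 2 (suc k)) (≰⇒> c≰))
    two-pieces : 2 ≤ length Ps
    two-pieces = ≤-trans (n≤1+n 2) (All.lookup X≥3 (∈-resp-⊆ Y⊆X (here refl)))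
    piece : ∀ {P} → LargeT m X (suc k) P × P ⊆ ys → Piece k C P
    piece (lP , P⊆ys) with penultimate-piece lP (⊆-trans (y ∷ʳ P⊆ys) Y⊆X)
    ... | q∈P , q<maxP , _ =
      lP , ⊆-trans (y ∷ʳ P⊆ys) Y⊆X ,
      cov (there (∈-resp-⊆ P⊆ys q∈P)) (<-≤-trans q<maxP (maxL-mono-⊆ (y ∷ʳ P⊆ys))) ,
      <-trans C<Y (head<tail incY (∈-resp-⊆ P⊆ys q∈P))

  covering-block-level : ∀ k → LevelBound k
  covering-block-level zero    = level-bound-base
  covering-block-level (suc k) = level-bound-step (covering-block-level k)

colour : List ℕ → ℕ → Bool
colour X a = a ≡ᵇ minL X

colour≡true⇒≡minL : ∀ X {a} → colour X a ≡ true → a ≡ minL X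
colour≡true⇒≡minL X {a} eq = ≡ᵇ⇒≡ a (minL X) (subst T (sym eq) tt)

colour≡false⇒minL< : ∀ {X a} → Increasing X → a ∈ X → colour X a ≡ false → minL X < a
colour≡false⇒minL< {x ∷ _} _   (here refl) eq = ⊥-elim (subst T eq (≡⇒≡ᵇ x x refl))
colour≡false⇒minL< {x ∷ _} inc (there a∈)  _  = head<tail inc a∈

proposition7p14 : (n : ℕ) → 1 ≤ n → (X : List ℕ) →
    Linked _<_ X → All (3 ≤_) X → Minimal (2 * n ∸ 1) X →
    ∃[ f ] ((Y : List ℕ) → Y ⊆ X → Homogeneous f Y →
      ¬ LargeT (2 * n ∸ 1) X n Y)
proposition7p14 (suc k) _ X X-linked X≥3 X-minimal = colour X , no-homogeneous-large
  where
  incX : Increasing X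
  incX = Linked⇒AllPairs <-trans X-linked
  open CoveringBlocks incX X≥3 X-minimal
  no-homogeneous-large : (Y : List ℕ) → Y ⊆ X → Homogeneous (colour X) Y →
    ¬ LargeT (2 * suc k ∸ 1) X (suc k) Y
  no-homogeneous-large [] _ _ ()
  no-homogeneous-large (y ∷ ys) Y⊆X (i , same) l
    with large⇒tail-nonempty l (positive (∈-resp-⊆ Y⊆X (here refl)))
  ... | a , _ , refl with i | same
  ... | true  | y-min ∷ a-min ∷ _ =
    <-irrefl (trans (colour≡true⇒≡minL X y-min) (sym (colour≡true⇒≡minL X a-min)))
      (head<tail (⊆X⇒increasing Y⊆X) (here refl))
  ... | false | y-coloured ∷ _ =
    -- X is its own canonical block, of level 2n - 1 < 2n
    <-irrefl refl (covering-block-level k l Y⊆X self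
      (colour≡false⇒minL< incX (∈-resp-⊆ Y⊆X (here refl)) y-coloured) (λ z∈ _ → ∈-resp-⊆ Y⊆X z∈))
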